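{- Let $H$ be a self-similar subgroup of $\Omega$. If $H$ contains an automorphism that has a stable cycle (of some length, at some level), then $H$ contains an odometer. In particular, if $H$ contains a settled element, then $H$ contains an odometer.
   Context: $T$ is the regular rooted binary tree whose vertices are finite words over $\{0,1\}$ (level $n$ = words of length $n$); $\Omega=\mathrm{Aut}(T)$, acting on the right. For $\gamma\in\Omega$ and a word $u$, the section $\gamma_u\in\Omega$ is the unique automorphism with $(uv)\gamma=(u)\gamma\,(v)\gamma_u$ for every word $v$. A subgroup $H\le\Omega$ is self-similar if $\gamma_0,\gamma_1\in H$ for every $\gamma\in H$ (hence all sections of elements of $H$ lie in $H$). An odometer is an element acting as a single $2^m$-cycle on level $m$ for every $m\ge1$. A vertex $v$ at level $n$ is in a stable cycle of length $k\ge1$ of $\gamma$ if the orbit $\{(v)\gamma^i:i\ge0\}$ has exactly $k$ elements and, for every $m>n$, all level-$m$ vertices lying above this orbit lie in a single cycle of $\gamma$ of length $2^{m-n}k$; $\gamma$ has a stable cycle if some vertex is in a stable cycle of $\gamma$. $\gamma$ is settled if the proportion of level-$n$ vertices lying in stable cycles of $\gamma$ tends to $1$ as $n\to\infty$. -}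

module Defs where

open import Data.Bool using (Bool)
open import Data.List using (List; []; _∷_; _++_; length; take; drop)
open import Data.List.Relation.Unary.Unique.Propositional using (Unique)
open import Data.List.Relation.Unary.All using (All)
open import Data.Nat using (ℕ; zero; suc; _*_; _∸_; _^_; _≤_; _<_)
open import Data.Product using (Σ; ∃; _×_)
open import Relation.Binary.PropositionalEquality using (_≡_)

-- Vertices of the binary rooted tree T: finite words over {0,1}
-- (false = 0, true = 1); level n = words of length n.
Word : Set
Word = List Bool

-- An automorphism of T (element of Ω = Aut(T)), acting on the right:
-- a bijection of the vertex set preserving levels and the ancestor relation.
record Aut : Set where
  field
    act        : Word → Word
    inv        : Word → Word
    inv-act    : ∀ w → inv (act w) ≡ w
    act-inv    : ∀ w → act (inv w) ≡ w
    act-length : ∀ w → length (act w) ≡ length w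
    act-prefix : ∀ u v → ∃ λ x → act (u ++ v) ≡ act u ++ x
open Aut public

iter : Aut → ℕ → Word → Word
iter γ zero    w = w
iter γ (suc i) w = act γ (iter γ i w)

OrbitSize : Aut → Word → ℕ → Set
OrbitSize γ w k =
  (1 ≤ k) ×
  (∀ i j → i < k → j < k → iter γ i w ≡ iter γ j w → i ≡ j) ×
  (iter γ k w ≡ w)

-- Subgroups of Ω, given as predicates on Aut (membership up to extensional
-- equality of the action).
IsSubgroup : (Aut → Set) → Set
IsSubgroup H =
  (Σ Aut λ e → H e × (∀ w → act e w ≡ w)) ×
  (∀ g h → H g → H h → Σ Aut λ k → H k × (∀ w → act k w ≡ act h (act g w))) ×
  (∀ g → H g → Σ Aut λ k → H k × (∀ w → act k w ≡ inv g w))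

IsSection : Aut → Word → Aut → Set
IsSection γ u δ = ∀ v → act δ v ≡ drop (length u) (act γ (u ++ v))

SelfSimilar : (Aut → Set) → Set
SelfSimilar H = ∀ γ → H γ → (b : Bool) →
  Σ Aut λ δ → H δ × IsSection γ (b ∷ []) δ

Odometer : Aut → Set
Odometer γ = ∀ m → 1 ≤ m →
  Σ Word λ w → (length w ≡ m) × OrbitSize γ w (2 ^ m) ×
    (∀ x → length x ≡ m → ∃ λ j → x ≡ iter γ j w)

StableIn : Aut → Word → ℕ → Set
StableIn γ v k =
  OrbitSize γ v k ×
  (∀ m → length v < m →
     Σ Word λ w → (length w ≡ m) × OrbitSize γ w (2 ^ (m ∸ length v) * k) ×
       (∀ x → length x ≡ m → (∃ λ i → take (length v) x ≡ iter γ i v) →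
          ∃ λ j → x ≡ iter γ j w))

InStableCycle : Aut → Word → Set
InStableCycle γ v = ∃ λ k → StableIn γ v k

HasStableCycle : Aut → Set
HasStableCycle γ = ∃ λ v → InStableCycle γ v

-- Settled: the proportion p_n of level-n vertices in stable cycles tends to 1,
-- i.e. for every k ≥ 1 there is N such that for all n ≥ N, 1 - p_n ≤ 1/k;
-- "p_n ≥ L / 2^n" is witnessed by L distinct level-n vertices in stable cycles.
Settled : Aut → Set
Settled γ = ∀ k → 1 ≤ k → ∃ λ N → ∀ n → N ≤ n →
  Σ (List Word) λ vs → Unique vs ×
    All (λ v → (length v ≡ n) × InStableCycle γ v) vs ×
    (k * (2 ^ n ∸ length vs) ≤ 2 ^ n)

{-# OPTIONS --safe #-}
-- If v lies in a stable cycle of length k of γ, then γ^k fixes v, and the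
-- section δ = (γ^k)_v is an odometer: the 2^m·k vertices m levels below the
-- orbit of v form one γ-cycle, and this cycle passes through the subtree at v
-- exactly once every k steps, each pass acting there as δ.  Closure under
-- products and sections puts δ in H.  A settled element has stable cycles,
-- since otherwise the proportion of vertices in stable cycles would stay 0.
module Submission where

open import Defs
open import Data.Bool using (false)
open import Data.List using ([]; _∷_; _++_; length; take; drop; replicate)
open import Data.List.Properties using (++-cancelˡ; length-++; length-replicate; drop-drop)
open import Data.List.Relation.Unary.All using (_∷_)
open import Data.Nat using (ℕ; zero; suc; _+_; _*_; _^_; _≤_; _<_; s≤s; z≤n; NonZero; >-nonZero)
open import Data.Nat.Properties
  using (+-comm; *-suc; *-cancelʳ-≡; *-monoˡ-<; m^n>0; m<m+n; m≤m+n; m+n∸m≡n; ≤-trans; ≤-refl; <⇒≱)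
open import Data.Nat.DivMod using (_%_; _/_; m≡m%n+[m/n]*n; m%n<n)
open import Data.Product using (Σ; ∃; _×_; _,_; proj₁; proj₂)
open import Data.Empty using (⊥-elim)
open import Relation.Binary.PropositionalEquality
open ≡-Reasoning

take-length-++ : ∀ (u x : Word) → take (length u) (u ++ x) ≡ u
take-length-++ []      x = refl
take-length-++ (b ∷ u) x = cong (b ∷_) (take-length-++ u x)

drop-length-++ : ∀ (u x : Word) → drop (length u) (u ++ x) ≡ x
drop-length-++ []      x = refl
drop-length-++ (b ∷ u) x = drop-length-++ u x

module _ (γ : Aut) where

  iter-+ : ∀ a b w → iter γ (a + b) w ≡ iter γ a (iter γ b w)
  iter-+ zero    b w = refl
  iter-+ (suc a) b w = cong (act γ) (iter-+ a b w)

  iter-comm : ∀ a b w → iter γ a (iter γ b w) ≡ iter γ b (iter γ a w)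
  iter-comm a b w = begin
    iter γ a (iter γ b w) ≡⟨ iter-+ a b w ⟨
    iter γ (a + b) w      ≡⟨ cong (λ t → iter γ t w) (+-comm a b) ⟩
    iter γ (b + a) w      ≡⟨ iter-+ b a w ⟩
    iter γ b (iter γ a w) ∎

  iter-length : ∀ i w → length (iter γ i w) ≡ length w
  iter-length zero    w = refl
  iter-length (suc i) w = trans (act-length γ _) (iter-length i w)

  iter-injective : ∀ i {y z} → iter γ i y ≡ iter γ i z → y ≡ z
  iter-injective zero    e = e
  iter-injective (suc i) {y} {z} e = iter-injective i (begin
    iter γ i y                 ≡⟨ inv-act γ _ ⟨
    inv γ (act γ (iter γ i y)) ≡⟨ cong (inv γ) e ⟩
    inv γ (act γ (iter γ i z)) ≡⟨ inv-act γ _ ⟩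
    iter γ i z                 ∎)

  iter-prefix : ∀ i u y → ∃ λ z → iter γ i (u ++ y) ≡ iter γ i u ++ z
  iter-prefix zero    u y = y , refl
  iter-prefix (suc i) u y with iter-prefix i u y
  ... | z , e with act-prefix γ (iter γ i u) z
  ... | z′ , e′ = z′ , trans (cong (act γ) e) e′

  take-iter : ∀ i u y → take (length u) (iter γ i (u ++ y)) ≡ iter γ i u
  take-iter i u y with iter-prefix i u y
  ... | z , e = begin
    take (length u) (iter γ i (u ++ y))          ≡⟨ cong (take (length u)) e ⟩
    take (length u) (iter γ i u ++ z)            ≡⟨ cong (λ l → take l (iter γ i u ++ z)) (iter-length i u) ⟨
    take (length (iter γ i u)) (iter γ i u ++ z) ≡⟨ take-length-++ (iter γ i u) z ⟩
    iter γ i u                                   ∎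

  iter-*-periodic : ∀ {N w} → iter γ N w ≡ w → ∀ j → iter γ (j * N) w ≡ w
  iter-*-periodic         p zero    = refl
  iter-*-periodic {N} {w} p (suc j) = begin
    iter γ (N + j * N) w        ≡⟨ iter-+ N (j * N) w ⟩
    iter γ N (iter γ (j * N) w) ≡⟨ cong (iter γ N) (iter-*-periodic p j) ⟩
    iter γ N w                  ≡⟨ p ⟩
    w                           ∎

  InOrbit : Word → Word → Set
  InOrbit w x = ∃ λ j → x ≡ iter γ j w

  inOrbit-trans : ∀ {w x y} → InOrbit w x → InOrbit x y → InOrbit w y
  inOrbit-trans {w} (i , refl) (j , refl) = j + i , sym (iter-+ j i w)

  inOrbit-sym : ∀ {w y N} → OrbitSize γ w N → InOrbit w y → InOrbit y w
  inOrbit-sym {w} {N = suc N′} (_ , _ , period) (j , refl) = j * N′ , (begin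
    w                            ≡⟨ iter-*-periodic period j ⟨
    iter γ (j * suc N′) w        ≡⟨ cong (λ t → iter γ t w) (trans (*-suc j N′) (+-comm j _)) ⟩
    iter γ (j * N′ + j) w        ≡⟨ iter-+ (j * N′) j w ⟩
    iter γ (j * N′) (iter γ j w) ∎)

  orbitSize-inOrbit : ∀ {w y N} → OrbitSize γ w N → InOrbit w y → OrbitSize γ y N
  orbitSize-inOrbit {w} {N = N} (1≤N , distinct , period) (j , refl) =
    1≤N , distinct′ , trans (iter-comm N j w) (cong (iter γ j) period)
    where
    distinct′ : ∀ a b → a < N → b < N → iter γ a (iter γ j w) ≡ iter γ b (iter γ j w) → a ≡ b
    distinct′ a b a<N b<N e = distinct a b a<N b<N
      (iter-injective j (trans (sym (iter-comm a j w)) (trans e (iter-comm b j w))))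

  stable-extensions : ∀ {v k} → StableIn γ v k → ∀ m → 1 ≤ m → ∀ x₀ → length x₀ ≡ m →
    OrbitSize γ (v ++ x₀) (2 ^ m * k) × (∀ x → length x ≡ m → InOrbit (v ++ x₀) (v ++ x))
  stable-extensions {v} {k} (_ , stable) m 1≤m x₀ ∣x₀∣≡m
    with stable (length v + m) (m<m+n (length v) 1≤m)
  ... | w , _ , w-orbit , covers = orbitSize-inOrbit w-orbit′ w→x₀ , reaches
    where
    w-orbit′ : OrbitSize γ w (2 ^ m * k)
    w-orbit′ = subst (λ t → OrbitSize γ w (2 ^ t * k)) (m+n∸m≡n (length v) m) w-orbit

    w→ : ∀ x → length x ≡ m → InOrbit w (v ++ x)
    w→ x ∣x∣≡m = covers (v ++ x) (trans (length-++ v) (cong (length v +_) ∣x∣≡m))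
                   (0 , take-length-++ v x)

    w→x₀ : InOrbit w (v ++ x₀)
    w→x₀ = w→ x₀ ∣x₀∣≡m

    reaches : ∀ x → length x ≡ m → InOrbit (v ++ x₀) (v ++ x)
    reaches x ∣x∣≡m = inOrbit-trans (inOrbit-sym w-orbit′ w→x₀) (w→ x ∣x∣≡m)

module PowerSection (γ : Aut) (v : Word) (k : ℕ) (δ : Aut)
  (δ-section : ∀ x → act δ x ≡ drop (length v) (iter γ k (v ++ x))) where

  iter-k-++ : iter γ k v ≡ v → ∀ x → iter γ k (v ++ x) ≡ v ++ act δ x
  iter-k-++ v-cycle x with iter-prefix γ k v x
  ... | z , e = begin
    iter γ k (v ++ x) ≡⟨ e′ ⟩
    v ++ z            ≡⟨ cong (v ++_) δx≡z ⟨
    v ++ act δ x      ∎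
    where
    e′ : iter γ k (v ++ x) ≡ v ++ z
    e′ = trans e (cong (_++ z) v-cycle)
    δx≡z : act δ x ≡ z
    δx≡z = trans (δ-section x) (trans (cong (drop (length v)) e′) (drop-length-++ v z))

  iter-*-++ : iter γ k v ≡ v → ∀ j x → iter γ (j * k) (v ++ x) ≡ v ++ iter δ j x
  iter-*-++ v-cycle zero    x = refl
  iter-*-++ v-cycle (suc j) x = begin
    iter γ (k + j * k) (v ++ x)        ≡⟨ iter-+ γ k (j * k) (v ++ x) ⟩
    iter γ k (iter γ (j * k) (v ++ x)) ≡⟨ cong (iter γ k) (iter-*-++ v-cycle j x) ⟩
    iter γ k (v ++ iter δ j x)         ≡⟨ iter-k-++ v-cycle (iter δ j x) ⟩
    v ++ iter δ (suc j) x              ∎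

  iter-++-divMod : .{{_ : NonZero k}} → iter γ k v ≡ v → ∀ t y →
    iter γ t (v ++ y) ≡ iter γ (t % k) (v ++ iter δ (t / k) y)
  iter-++-divMod v-cycle t y = begin
    iter γ t (v ++ y)                            ≡⟨ cong (λ s → iter γ s (v ++ y)) (m≡m%n+[m/n]*n t k) ⟩
    iter γ (t % k + t / k * k) (v ++ y)          ≡⟨ iter-+ γ (t % k) (t / k * k) (v ++ y) ⟩
    iter γ (t % k) (iter γ (t / k * k) (v ++ y)) ≡⟨ cong (iter γ (t % k)) (iter-*-++ v-cycle (t / k) y) ⟩
    iter γ (t % k) (v ++ iter δ (t / k) y)       ∎

  stable⇒odometer : StableIn γ v k → Odometer δ
  stable⇒odometer stable@((1≤k , v-distinct , v-cycle) , _) m 1≤m =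
    x₀ , length-replicate m , (m^n>0 2 m , distinct , period) , covers
    where
    instance
      k-nonZero : NonZero k
      k-nonZero = >-nonZero 1≤k

    x₀ : Word
    x₀ = replicate m false

    y₀-orbit : OrbitSize γ (v ++ x₀) (2 ^ m * k)
    y₀-orbit = proj₁ (stable-extensions γ stable m 1≤m x₀ (length-replicate m))

    reaches : ∀ x → length x ≡ m → InOrbit γ (v ++ x₀) (v ++ x)
    reaches = proj₂ (stable-extensions γ stable m 1≤m x₀ (length-replicate m))

    distinct : ∀ i j → i < 2 ^ m → j < 2 ^ m → iter δ i x₀ ≡ iter δ j x₀ → i ≡ j
    distinct i j i< j< e = *-cancelʳ-≡ i j k
      (proj₁ (proj₂ y₀-orbit) (i * k) (j * k) (*-monoˡ-< k i<) (*-monoˡ-< k j<)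
        (trans (iter-*-++ v-cycle i x₀) (trans (cong (v ++_) e) (sym (iter-*-++ v-cycle j x₀)))))

    period : iter δ (2 ^ m) x₀ ≡ x₀
    period = ++-cancelˡ v _ _ (trans (sym (iter-*-++ v-cycle (2 ^ m) x₀))
                                     (proj₂ (proj₂ y₀-orbit)))

    covers : ∀ x → length x ≡ m → ∃ λ j → x ≡ iter δ j x₀
    covers x ∣x∣≡m with reaches x ∣x∣≡m
    ... | t , e = t / k , ++-cancelˡ v _ _ (trans e′ (cong (λ s → iter γ s (v ++ iter δ (t / k) x₀)) r≡0))
      where
      e′ : v ++ x ≡ iter γ (t % k) (v ++ iter δ (t / k) x₀)
      e′ = trans e (iter-++-divMod v-cycle t x₀)
      r≡0 : t % k ≡ 0
      r≡0 = v-distinct (t % k) 0 (m%n<n t k) 1≤k (begin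
        iter γ (t % k) v                                          ≡⟨ take-iter γ (t % k) v _ ⟨
        take (length v) (iter γ (t % k) (v ++ iter δ (t / k) x₀)) ≡⟨ cong (take (length v)) e′ ⟨
        take (length v) (v ++ x)                                  ≡⟨ take-length-++ v x ⟩
        v                                                         ∎)

module _ {H : Aut → Set} where

  power-∈ : IsSubgroup H → ∀ {γ} → H γ → ∀ k → Σ Aut λ p → H p × (∀ w → act p w ≡ iter γ k w)
  power-∈ ((e , e∈H , e-id) , _) γ∈H zero = e , e∈H , e-id
  power-∈ subgroup@(_ , product-∈ , _) {γ} γ∈H (suc k) with power-∈ subgroup γ∈H k
  ... | p , p∈H , p-act with product-∈ p γ p∈H γ∈H
  ... | q , q∈H , q-act = q , q∈H , λ w → trans (q-act w) (cong (act γ) (p-act w))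

  section-∈ : SelfSimilar H → ∀ {γ} → H γ → ∀ u → Σ Aut λ δ → H δ × IsSection γ u δ
  section-∈ self-similar {γ} γ∈H []      = γ , γ∈H , λ _ → refl
  section-∈ self-similar {γ} γ∈H (b ∷ u) with self-similar γ γ∈H b
  ... | δ , δ∈H , δ-section with section-∈ self-similar δ∈H u
  ... | ε , ε∈H , ε-section = ε , ε∈H , λ x → begin
    act ε x                                       ≡⟨ ε-section x ⟩
    drop (length u) (act δ (u ++ x))              ≡⟨ cong (drop (length u)) (δ-section (u ++ x)) ⟩
    drop (length u) (drop 1 (act γ (b ∷ u ++ x))) ≡⟨ drop-drop 1 (length u) (act γ (b ∷ u ++ x)) ⟩
    drop (suc (length u)) (act γ (b ∷ u ++ x))    ∎

  stableCycle⇒odometer-∈ : IsSubgroup H → SelfSimilar H → ∀ {γ} → H γ → HasStableCycle γ →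
    Σ Aut λ ω → H ω × Odometer ω
  stableCycle⇒odometer-∈ subgroup self-similar {γ} γ∈H (v , k , stable)
    with power-∈ subgroup γ∈H k
  ... | p , p∈H , p-act with section-∈ self-similar p∈H v
  ... | δ , δ∈H , δ-section =
    δ , δ∈H , PowerSection.stable⇒odometer γ v k δ
                (λ x → trans (δ-section x) (cong (drop (length v)) (p-act (v ++ x)))) stable

settled⇒hasStableCycle : ∀ {γ} → Settled γ → HasStableCycle γ
settled⇒hasStableCycle settled with settled 2 (s≤s z≤n)
... | N , eventually with eventually N ≤-refl
... | u ∷ _ , _ , (_ , u-stable) ∷ _ , _ = u , u-stable
... | [] , _ , _ , 2*2^N≤2^N =
  ⊥-elim (<⇒≱ (m<m+n (2 ^ N) (≤-trans (m^n>0 2 N) (m≤m+n (2 ^ N) 0))) 2*2^N≤2^N)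

corollary5p7 : (H : Aut → Set) → IsSubgroup H → SelfSimilar H →
    ((Σ Aut λ γ → H γ × HasStableCycle γ) → Σ Aut λ ω → H ω × Odometer ω) ×
    ((Σ Aut λ γ → H γ × Settled γ) → Σ Aut λ ω → H ω × Odometer ω)
corollary5p7 H subgroup self-similar =
  (λ { (γ , γ∈H , stable) → stableCycle⇒odometer-∈ subgroup self-similar γ∈H stable }) ,
  (λ { (γ , γ∈H , settled) → stableCycle⇒odometer-∈ subgroup self-similar γ∈H (settled⇒hasStableCycle settled) })
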